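{- Let $\langle A,\land_B,\rightarrowtail,0\rangle$ be a Brignole algebra. Define $x\land y:=x\land_B y$, $x\lor y:=((x\rightarrowtail 0)\land_B(y\rightarrowtail 0))\rightarrowtail 0$, $x\to y:=x\rightarrowtail(x\rightarrowtail y)$, $\sim x:=x\rightarrowtail 0$ and $1:=0\rightarrowtail 0$. Then $\langle A,\land,\lor,\to,\sim,1\rangle$ is a Nelson algebra.
   Context: A Brignole algebra is an algebra $\langle A,\land_B,\rightarrowtail,0\rangle$ of type $(2,2,0)$ such that, with $\sim_B x:=x\rightarrowtail 0$ and $x\lor_B y:=((x\rightarrowtail 0)\land_B(y\rightarrowtail 0))\rightarrowtail 0$, for all $x,y,z$: (B1) $(x\rightarrowtail x)\rightarrowtail y=y$; (B2) $(x\rightarrowtail y)\land_B y=y$; (B3) $x\land_B\sim_B(x\land_B\sim_B y)=x\land_B(x\rightarrowtail y)$; (B4) $x\rightarrowtail(y\land_B z)=(x\rightarrowtail y)\land_B(x\rightarrowtail z)$; (B5) $x\rightarrowtail y=\sim_B y\rightarrowtail\sim_B x$; (B6) $x\rightarrowtail(x\rightarrowtail(y\rightarrowtail(y\rightarrowtail z)))=(x\land_B y)\rightarrowtail((x\land_B y)\rightarrowtail z)$; (B7) $\sim_B(\sim_B x\land_B y)\rightarrowtail(x\rightarrowtail y)=x\rightarrowtail y$; (B8) $x\land_B(x\lor_B y)=x$; (B9) $x\land_B(y\lor_B z)=(z\land_B x)\lor_B(y\land_B x)$; (B10) $(x\land_B\sim_B x)\land_B(y\lor_B\sim_B y)=x\land_B\sim_B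 x$. A Nelson algebra is an algebra $\langle A,\land,\lor,\to,\sim,1\rangle$ of type $(2,2,2,1,0)$ satisfying, for all $x,y,z$: (N1) $x\land(x\lor y)=x$; (N2) $x\land(y\lor z)=(z\land x)\lor(y\land x)$; (N3) $\sim\sim x=x$; (N4) $\sim(x\land y)=\sim x\lor\sim y$; (N5) $x\land\sim x=(x\land\sim x)\land(y\lor\sim y)$; (N6) $x\to x=1$; (N7) $x\land(x\to y)=x\land(\sim x\lor y)$; (N8) $(x\land y)\to z=x\to(y\to z)$. -}

module Defs where

open import Level using (Level; suc)
open import Relation.Binary.PropositionalEquality using (_≡_)

record IsBrignole {a : Level} (A : Set a) (_∧B_ : A → A → A) (_↣_ : A → A → A) (𝟘 : A) : Set a where
  ∼B : A → A
  ∼B x = x ↣ 𝟘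
  _∨B_ : A → A → A
  x ∨B y = ((x ↣ 𝟘) ∧B (y ↣ 𝟘)) ↣ 𝟘
  field
    B1  : ∀ x y → (x ↣ x) ↣ y ≡ y
    B2  : ∀ x y → (x ↣ y) ∧B y ≡ y
    B3  : ∀ x y → x ∧B ∼B (x ∧B ∼B y) ≡ x ∧B (x ↣ y)
    B4  : ∀ x y z → x ↣ (y ∧B z) ≡ (x ↣ y) ∧B (x ↣ z)
    B5  : ∀ x y → x ↣ y ≡ ∼B y ↣ ∼B x
    B6  : ∀ x y z → x ↣ (x ↣ (y ↣ (y ↣ z))) ≡ (x ∧B y) ↣ ((x ∧B y) ↣ z)
    B7  : ∀ x y → ∼B (∼B x ∧B y) ↣ (x ↣ y) ≡ x ↣ y
    B8  : ∀ x y → x ∧B (x ∨B y) ≡ x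
    B9  : ∀ x y z → x ∧B (y ∨B z) ≡ (z ∧B x) ∨B (y ∧B x)
    B10 : ∀ x y → (x ∧B ∼B x) ∧B (y ∨B ∼B y) ≡ x ∧B ∼B x

record IsNelson {a : Level} (A : Set a) (_∧_ _∨_ _⇒_ : A → A → A) (∼ : A → A) (𝟙 : A) : Set a where
  field
    N1 : ∀ x y → x ∧ (x ∨ y) ≡ x
    N2 : ∀ x y z → x ∧ (y ∨ z) ≡ (z ∧ x) ∨ (y ∧ x)
    N3 : ∀ x → ∼ (∼ x) ≡ x
    N4 : ∀ x y → ∼ (x ∧ y) ≡ ∼ x ∨ ∼ y
    N5 : ∀ x y → x ∧ ∼ x ≡ (x ∧ ∼ x) ∧ (y ∨ ∼ y)
    N6 : ∀ x → x ⇒ x ≡ 𝟙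
    N7 : ∀ x y → x ∧ (x ⇒ y) ≡ x ∧ (∼ x ∨ y)
    N8 : ∀ x y z → (x ∧ y) ⇒ z ≡ x ⇒ (y ⇒ z)

module BrignoleToNelson {a : Level} {A : Set a} (_∧B_ _↣_ : A → A → A) (𝟘 : A) where
  _∧N_ : A → A → A
  x ∧N y = x ∧B y
  _∨N_ : A → A → A
  x ∨N y = ((x ↣ 𝟘) ∧B (y ↣ 𝟘)) ↣ 𝟘
  _⇒N_ : A → A → A
  x ⇒N y = x ↣ (x ↣ y)
  ∼N : A → A
  ∼N x = x ↣ 𝟘
  𝟙N : A
  𝟙N = 𝟘 ↣ 𝟘

-- N1, N2, N5 and N8 are B8, B9, B10 and B6 read backwards.  B1 and B5 make
-- ∼ an involution, which turns the defined ∨ into the De Morgan dual of ∧ and,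
-- with B8 and B9, yields idempotence, commutativity and distributivity.  Every
-- y ↣ y equals 1, and B2 makes 1 the top element, so x ⇒ x = x ↣ 1 = 1.  For N7,
-- B3 says x ∧ (∼x ∨ y) = x ∧ (x ↣ y); applying it twice and distributing,
-- x ∧ (x ↣ (x ↣ y)) = (x ∧ ∼x) ∨ (x ∧ ∼x) ∨ (x ∧ y) = x ∧ (∼x ∨ y).
module Submission where

open import Defs
open import Level using (Level)
open import Relation.Binary.PropositionalEquality
open ≡-Reasoning

module BrignoleProperties {a : Level} {A : Set a} {_∧_ _↣_ : A → A → A} {𝟘 : A}
                          (brignole : IsBrignole A _∧_ _↣_ 𝟘) where
  open IsBrignole brignole

  𝟙 : A
  𝟙 = 𝟘 ↣ 𝟘

  ∼-involutive : ∀ x → ∼B (∼B x) ≡ x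
  ∼-involutive x = begin
    (x ↣ 𝟘) ↣ 𝟘               ≡⟨ cong ((x ↣ 𝟘) ↣_) (sym (B1 x 𝟘)) ⟩
    (x ↣ 𝟘) ↣ ((x ↣ x) ↣ 𝟘)   ≡⟨ sym (B5 (x ↣ x) x) ⟩
    (x ↣ x) ↣ x               ≡⟨ B1 x x ⟩
    x                         ∎

  ∼-deMorgan : ∀ x y → ∼B (x ∧ y) ≡ ∼B x ∨B ∼B y
  ∼-deMorgan x y = sym (cong ∼B (cong₂ _∧_ (∼-involutive x) (∼-involutive y)))

  ∨-absorbs-∧ : ∀ x y → x ∨B (x ∧ y) ≡ x
  ∨-absorbs-∧ x y = begin
    ∼B (∼B x ∧ ∼B (x ∧ y))        ≡⟨ cong (λ t → ∼B (∼B x ∧ t)) (∼-deMorgan x y) ⟩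
    ∼B (∼B x ∧ (∼B x ∨B ∼B y))    ≡⟨ cong ∼B (B8 (∼B x) (∼B y)) ⟩
    ∼B (∼B x)                     ≡⟨ ∼-involutive x ⟩
    x                             ∎

  ∧-idem : ∀ x → x ∧ x ≡ x
  ∧-idem x = trans (cong (x ∧_) (sym (∨-absorbs-∧ x x))) (B8 x (x ∧ x))

  ∨-idem : ∀ x → x ∨B x ≡ x
  ∨-idem x = trans (cong ∼B (∧-idem (∼B x))) (∼-involutive x)

  -- B9 with y = z swaps the two arguments of ∧.
  ∧-comm : ∀ x y → x ∧ y ≡ y ∧ x
  ∧-comm x y = begin
    x ∧ y                ≡⟨ cong (x ∧_) (sym (∨-idem y)) ⟩
    x ∧ (y ∨B y)         ≡⟨ B9 x y y ⟩
    (y ∧ x) ∨B (y ∧ x)   ≡⟨ ∨-idem (y ∧ x) ⟩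
    y ∧ x                ∎

  ∨-comm : ∀ x y → x ∨B y ≡ y ∨B x
  ∨-comm x y = cong ∼B (∧-comm (∼B x) (∼B y))

  ∧-distribˡ-∨ : ∀ x y z → x ∧ (y ∨B z) ≡ (x ∧ y) ∨B (x ∧ z)
  ∧-distribˡ-∨ x y z = begin
    x ∧ (y ∨B z)         ≡⟨ B9 x y z ⟩
    (z ∧ x) ∨B (y ∧ x)   ≡⟨ cong₂ _∨B_ (∧-comm z x) (∧-comm y x) ⟩
    (x ∧ z) ∨B (x ∧ y)   ≡⟨ ∨-comm (x ∧ z) (x ∧ y) ⟩
    (x ∧ y) ∨B (x ∧ z)   ∎

  ∨-absorbs-∨ : ∀ x y → x ∨B (x ∨B y) ≡ x ∨B y
  ∨-absorbs-∨ x y = begin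
    x ∨B w          ≡⟨ cong (_∨B w) (sym (B8 x y)) ⟩
    (x ∧ w) ∨B w    ≡⟨ cong (_∨B w) (∧-comm x w) ⟩
    (w ∧ x) ∨B w    ≡⟨ ∨-comm (w ∧ x) w ⟩
    w ∨B (w ∧ x)    ≡⟨ ∨-absorbs-∧ w x ⟩
    w               ∎
    where w = x ∨B y

  ↣-refl : ∀ x → x ↣ x ≡ 𝟙
  ↣-refl x = begin
    x ↣ x                          ≡⟨ sym (B1 x (x ↣ x)) ⟩
    (x ↣ x) ↣ (x ↣ x)              ≡⟨ B5 (x ↣ x) (x ↣ x) ⟩
    ∼B (x ↣ x) ↣ ∼B (x ↣ x)        ≡⟨ cong₂ _↣_ (B1 x 𝟘) (B1 x 𝟘) ⟩
    𝟙                              ∎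

  ∧-identityˡ : ∀ x → 𝟙 ∧ x ≡ x
  ∧-identityˡ x = trans (cong (_∧ x) (sym (↣-refl x))) (B2 x x)

  ↣-zeroʳ : ∀ x → x ↣ 𝟙 ≡ 𝟙
  ↣-zeroʳ x = begin
    x ↣ 𝟙          ≡⟨ sym (∧-identityˡ (x ↣ 𝟙)) ⟩
    𝟙 ∧ (x ↣ 𝟙)    ≡⟨ ∧-comm 𝟙 (x ↣ 𝟙) ⟩
    (x ↣ 𝟙) ∧ 𝟙    ≡⟨ B2 x 𝟙 ⟩
    𝟙              ∎

  ∧-∼∨≡∧-↣ : ∀ x y → x ∧ (∼B x ∨B y) ≡ x ∧ (x ↣ y)
  ∧-∼∨≡∧-↣ x y =
    trans (cong (λ t → x ∧ ∼B (t ∧ ∼B y)) (∼-involutive x)) (B3 x y)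

  ∧-↣↣≡∧-∼∨ : ∀ x y → x ∧ (x ↣ (x ↣ y)) ≡ x ∧ (∼B x ∨B y)
  ∧-↣↣≡∧-∼∨ x y = begin
    x ∧ (x ↣ (x ↣ y))                 ≡⟨ sym (∧-∼∨≡∧-↣ x (x ↣ y)) ⟩
    x ∧ (∼B x ∨B (x ↣ y))             ≡⟨ ∧-distribˡ-∨ x (∼B x) (x ↣ y) ⟩
    c ∨B (x ∧ (x ↣ y))                ≡⟨ cong (c ∨B_) (sym (∧-∼∨≡∧-↣ x y)) ⟩
    c ∨B (x ∧ (∼B x ∨B y))            ≡⟨ cong (c ∨B_) (∧-distribˡ-∨ x (∼B x) y) ⟩
    c ∨B (c ∨B (x ∧ y))               ≡⟨ ∨-absorbs-∨ c (x ∧ y) ⟩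
    c ∨B (x ∧ y)                      ≡⟨ sym (∧-distribˡ-∨ x (∼B x) y) ⟩
    x ∧ (∼B x ∨B y)                   ∎
    where c = x ∧ ∼B x

mainTheorem5 : {a : Level} (A : Set a) (_∧B_ _↣_ : A → A → A) (𝟘 : A) →
    IsBrignole A _∧B_ _↣_ 𝟘 →
    IsNelson A (BrignoleToNelson._∧N_ _∧B_ _↣_ 𝟘) (BrignoleToNelson._∨N_ _∧B_ _↣_ 𝟘)
      (BrignoleToNelson._⇒N_ _∧B_ _↣_ 𝟘) (BrignoleToNelson.∼N _∧B_ _↣_ 𝟘)
      (BrignoleToNelson.𝟙N _∧B_ _↣_ 𝟘)
mainTheorem5 A _∧B_ _↣_ 𝟘 brignole = record
  { N1 = B8
  ; N2 = B9
  ; N3 = ∼-involutive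
  ; N4 = ∼-deMorgan
  ; N5 = λ x y → sym (B10 x y)
  ; N6 = λ x → trans (cong (x ↣_) (↣-refl x)) (↣-zeroʳ x)
  ; N7 = ∧-↣↣≡∧-∼∨
  ; N8 = λ x y z → sym (B6 x y z)
  }
  where
  open IsBrignole brignole
  open BrignoleProperties brignole
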